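{- Let $m,n\ge 0$. An $(m,n)$-word $\mathfrak{w}\in\mathsf{W}(m,n)$ is join-irreducible in $\mathbf{W}(m,n)$ if and only if either $\mathfrak{w}=\mathfrak{a}^{(i,j)}$ for some $i\in\{1,\dots,n\}$ and $j\in\{1,\dots,m\}$, or $\mathfrak{w}=\mathfrak{b}^{(i)}$ for some $i\in\{2,\dots,n\}$.
   Context: An $(m,n)$-word is a word $\mathfrak{w}=w_1w_2\cdots w_n$ of length $n$ over the alphabet $\{0,1,\dots,m+1\}$ such that (MN1) $w_1\neq m+1$, and (MN2) for every $s$ with $1\le s\le m$ and every index $i$, if $w_i=s$ then $w_j\ge s$ for all $j<i$. $\mathsf{W}(m,n)$ is the set of $(m,n)$-words and $\mathbf{W}(m,n)$ is $\mathsf{W}(m,n)$ ordered componentwise; it is a lattice. An element $x$ of a finite lattice is join-irreducible if $x=p\vee q$ implies $p=x$ or $q=x$ (equivalently, $x$ covers exactly one element; the bottom is not join-irreducible). For $i\in\{1,\dots,n\}$, $j\in\{0,\dots,m\}$, $\mathfrak{a}^{(i,j)}$ is the word with letters $a_k=j$ for $k\le i$ and $a_k=0$ for $k>i$; for $i\in\{2,\dots,n\}$, $\mathfrak{b}^{(i)}$ is the word with $b_i=m+1$ and $b_k=0$ for $k\ne i$. -}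

module Defs where

open import Data.Nat using (ℕ; zero; suc; _≤_; _<_; _≥_)
open import Data.Fin using (Fin; toℕ)
open import Data.Product using (_×_; Σ; ∃-syntax)
open import Data.Sum using (_⊎_)
open import Relation.Binary.PropositionalEquality using (_≡_; _≢_)
open import Relation.Nullary using (¬_)

-- A word of length n over ℕ; position k : Fin n stands for index (toℕ k + 1).
Word : ℕ → Set
Word n = Fin n → ℕ

IsMNWord : (m n : ℕ) → Word n → Set
IsMNWord m n w =
  (∀ k → w k ≤ suc m)
  × (∀ k → toℕ k ≡ 0 → w k ≢ suc m)
  × (∀ i j s → 1 ≤ s → s ≤ m → w i ≡ s → toℕ j < toℕ i → s ≤ w j)

_≤ʷ_ : ∀ {n} → Word n → Word n → Set
u ≤ʷ v = ∀ k → u k ≤ v k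

_≈ʷ_ : ∀ {n} → Word n → Word n → Set
u ≈ʷ v = ∀ k → u k ≡ v k

IsJoinIn : (m n : ℕ) → Word n → Word n → Word n → Set
IsJoinIn m n p q x =
  IsMNWord m n x × p ≤ʷ x × q ≤ʷ x
  × (∀ z → IsMNWord m n z → p ≤ʷ z → q ≤ʷ z → x ≤ʷ z)

IsBottomIn : (m n : ℕ) → Word n → Set
IsBottomIn m n x = IsMNWord m n x × (∀ z → IsMNWord m n z → x ≤ʷ z)

JoinIrreducible : (m n : ℕ) → Word n → Set
JoinIrreducible m n x =
  ¬ IsBottomIn m n x
  × (∀ p q → IsMNWord m n p → IsMNWord m n q → IsJoinIn m n p q x
       → p ≈ʷ x ⊎ q ≈ʷ x)

wordA : ∀ {n} → ℕ → ℕ → Word n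
wordA i j k with suc (toℕ k) Data.Nat.≤? i
... | Relation.Nullary.yes _ = j
... | Relation.Nullary.no _ = 0

wordB : ∀ {n} → ℕ → ℕ → Word n
wordB m i k with suc (toℕ k) Data.Nat.≟ i
... | Relation.Nullary.yes _ = suc m
... | Relation.Nullary.no _ = 0

-- W(m,n) is closed under the componentwise maximum, so joins are computed
-- letterwise and the zero word is the bottom.  Every word w is the join of its
-- principal parts: for each position k the least word below w with letter w_k
-- at k, namely a^(k,w_k) if w_k ≤ m and b^(k) if w_k = m+1.  A join-irreducible
-- word must equal one of them, which gives the list.  Conversely, a^(i,j) and
-- b^(i) each have a pivot position i: a word below them that keeps the letter
-- at i is the whole word, and all words that lower the letter at i lie below a
-- single word y, namely a^(i-1,j) ∨ a^(i,j-1) resp. a^(i,m).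
module Submission where

open import Defs
open import Data.Nat using (ℕ; zero; suc; _≤_; _<_; _⊔_; z≤n; s≤s; s≤s⁻¹; _≤?_; _≟_)
open import Data.Nat.Properties
open import Data.Fin using (Fin; toℕ; fromℕ<)
import Data.Fin as Fin
open import Data.Fin.Properties using (toℕ<n; toℕ-fromℕ<; toℕ-injective) renaming (<-cmp to <-cmpᶠ; _≟_ to _≟ᶠ_)
open import Data.Product using (_×_; _,_; ∃-syntax)
open import Data.Sum using (_⊎_; inj₁; inj₂)
open import Function.Base using (_∘_)
open import Function.Bundles using (_⇔_; mk⇔)
open import Relation.Nullary using (¬_; yes; no; contradiction)
open import Relation.Binary.Definitions using (tri<; tri≈; tri>)
open import Relation.Binary.PropositionalEquality using (_≡_; _≢_; refl; sym; trans; cong₂; subst; subst₂)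

private variable
  m n r i j : ℕ
  w x p q : Word n
  k l t : Fin n

IsAWord : (m n : ℕ) → Word n → Set
IsAWord m n w = ∃[ i ] ∃[ j ] (1 ≤ i × i ≤ n × 1 ≤ j × j ≤ m × w ≈ʷ wordA i j)

IsBWord : (m n : ℕ) → Word n → Set
IsBWord m n w = ∃[ i ] (2 ≤ i × i ≤ n × w ≈ʷ wordB m i)

≤ʷ-zero : p ≤ʷ x → x k ≡ 0 → p k ≡ 0
≤ʷ-zero {k = k} p≤x xk≡0 = n≤0⇒n≡0 (subst (_ ≤_) xk≡0 (p≤x k))

≤m⇒earlier-≥ : IsMNWord m n w → w k ≤ m → toℕ l < toℕ k → w k ≤ w l
≤m⇒earlier-≥ {w = w} {k = k} (_ , _ , mn2) wk≤m l<k with w k in wk≡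
... | zero = z≤n
... | suc s = mn2 k _ (suc s) (s≤s z≤n) wk≤m wk≡ l<k

≰m⇒≡suc : IsMNWord m n w → ¬ w k ≤ m → w k ≡ suc m
≰m⇒≡suc {k = k} (bounded , _ , _) wk≰m = ≤-antisym (bounded k) (≰⇒> wk≰m)

≰m⇒position>0 : IsMNWord m n w → ¬ w k ≤ m → 1 ≤ toℕ k
≰m⇒position>0 {k = k} w∈W@(_ , mn1 , _) wk≰m =
  n≢0⇒n>0 (λ k≡0 → mn1 k k≡0 (≰m⇒≡suc w∈W wk≰m))

0ʷ : Word n
0ʷ _ = 0

infixl 30 _⊔ʷ_

_⊔ʷ_ : Word n → Word n → Word n
(p ⊔ʷ q) k = p k ⊔ q k

0ʷ-isMNWord : IsMNWord m n 0ʷ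
0ʷ-isMNWord = (λ _ → z≤n) , (λ _ _ ()) , λ { _ _ _ () _ refl _ }

0ʷ-isBottom : IsMNWord m n w → w ≈ʷ 0ʷ → IsBottomIn m n w
0ʷ-isBottom w∈W w≈0 = w∈W , λ z _ k → subst (_≤ z k) (sym (w≈0 k)) z≤n

⊔ʷ-isMNWord : IsMNWord m n p → IsMNWord m n q → IsMNWord m n (p ⊔ʷ q)
⊔ʷ-isMNWord {m = m} {p = p} {q = q} (p-bd , p-mn1 , p-mn2) (q-bd , q-mn1 , q-mn2) =
  (λ k → ⊔-lub (p-bd k) (q-bd k)) , mn1 , mn2
  where
  mn1 : ∀ k → toℕ k ≡ 0 → p k ⊔ q k ≢ suc m
  mn1 k k≡0 eq with ⊔-sel (p k) (q k)
  ... | inj₁ e = p-mn1 k k≡0 (trans (sym e) eq)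
  ... | inj₂ e = q-mn1 k k≡0 (trans (sym e) eq)
  mn2 : ∀ a b s → 1 ≤ s → s ≤ m → p a ⊔ q a ≡ s → toℕ b < toℕ a → s ≤ p b ⊔ q b
  mn2 a b s 1≤s s≤m eq b<a with ⊔-sel (p a) (q a)
  ... | inj₁ e = ≤-trans (p-mn2 a b s 1≤s s≤m (trans (sym e) eq) b<a) (m≤m⊔n (p b) (q b))
  ... | inj₂ e = ≤-trans (q-mn2 a b s 1≤s s≤m (trans (sym e) eq) b<a) (m≤n⊔m (p b) (q b))

⊔ʷ-isJoin : IsMNWord m n w → w ≈ʷ p ⊔ʷ q → IsJoinIn m n p q w
⊔ʷ-isJoin {p = p} {q = q} w∈W w≈p⊔q =
  w∈W
  , (λ k → subst (p k ≤_) (sym (w≈p⊔q k)) (m≤m⊔n (p k) (q k)))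
  , (λ k → subst (q k ≤_) (sym (w≈p⊔q k)) (m≤n⊔m (p k) (q k)))
  , λ z _ p≤z q≤z k → subst (_≤ z k) (sym (w≈p⊔q k)) (⊔-lub (p≤z k) (q≤z k))

⋁ : (Fin r → Word n) → Word n
⋁ {r = zero} f = 0ʷ
⋁ {r = suc r} f = f Fin.zero ⊔ʷ ⋁ (f ∘ Fin.suc)

⋁-isMNWord : (f : Fin r → Word n) → (∀ k → IsMNWord m n (f k)) → IsMNWord m n (⋁ f)
⋁-isMNWord {r = zero} f _ = 0ʷ-isMNWord
⋁-isMNWord {r = suc r} f f∈W = ⊔ʷ-isMNWord (f∈W _) (⋁-isMNWord (f ∘ Fin.suc) (f∈W ∘ Fin.suc))

⋁-upper : (f : Fin r → Word n) (k : Fin r) → f k ≤ʷ ⋁ f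
⋁-upper f Fin.zero l = m≤m⊔n _ _
⋁-upper f (Fin.suc k) l = ≤-trans (⋁-upper (f ∘ Fin.suc) k l) (m≤n⊔m _ _)

⋁-least : (f : Fin r → Word n) → (∀ k → f k ≤ʷ w) → ⋁ f ≤ʷ w
⋁-least {r = zero} f _ _ = z≤n
⋁-least {r = suc r} f f≤w l = ⊔-lub (f≤w _ l) (⋁-least (f ∘ Fin.suc) (f≤w ∘ Fin.suc) l)

joinIrreducible⇒joinand : IsMNWord m n w → JoinIrreducible m n w →
  (f : Fin r → Word n) → (∀ k → IsMNWord m n (f k)) → w ≈ʷ ⋁ f → ∃[ k ] f k ≈ʷ w
joinIrreducible⇒joinand {r = zero} w∈W (w≠⊥ , _) f _ w≈⋁ =
  contradiction (0ʷ-isBottom w∈W w≈⋁) w≠⊥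
joinIrreducible⇒joinand {r = suc r} w∈W w-ji@(_ , irreducible) f f∈W w≈⋁
  with irreducible _ _ (f∈W _) (⋁-isMNWord _ (f∈W ∘ Fin.suc)) (⊔ʷ-isJoin w∈W w≈⋁)
... | inj₁ f0≈w = Fin.zero , f0≈w
... | inj₂ ⋁≈w with joinIrreducible⇒joinand w∈W w-ji (f ∘ Fin.suc) (f∈W ∘ Fin.suc) (sym ∘ ⋁≈w)
...   | k , fk≈w = Fin.suc k , fk≈w

wordA-inside : toℕ k < i → wordA i j k ≡ j
wordA-inside {k = k} {i = i} k<i with suc (toℕ k) ≤? i
... | yes _ = refl
... | no k≮i = contradiction k<i k≮i

wordA-outside : i ≤ toℕ k → wordA i j k ≡ 0
wordA-outside {i = i} {k = k} i≤k with suc (toℕ k) ≤? i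
... | yes k<i = contradiction i≤k (<⇒≱ k<i)
... | no _ = refl

wordA-≤ : (k : Fin n) → wordA i j k ≤ j
wordA-≤ {i = i} k with suc (toℕ k) ≤? i
... | yes _ = ≤-refl
... | no _ = z≤n

wordA-isMNWord : j ≤ m → IsMNWord m n (wordA i j)
wordA-isMNWord {j = j} {m = m} {i = i} j≤m =
  (λ k → ≤-trans (wordA-≤ k) (m≤n⇒m≤1+n j≤m))
  , (λ k _ eq → 1+n≰n (subst (_≤ m) eq (≤-trans (wordA-≤ k) j≤m)))
  , mn2
  where
  mn2 : ∀ a b s → 1 ≤ s → s ≤ m → wordA i j a ≡ s → toℕ b < toℕ a → s ≤ wordA i j b
  mn2 a b s 1≤s _ wa≡s b<a with i ≤? toℕ a
  ... | yes i≤a = contradiction (trans (sym wa≡s) (wordA-outside i≤a)) (n>0⇒n≢0 1≤s)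
  ... | no i≰a = ≤-reflexive (trans (sym wa≡s)
                   (trans (wordA-inside a<i) (sym (wordA-inside (<-trans b<a a<i)))))
    where
    a<i : toℕ a < i
    a<i = ≰⇒> i≰a

wordB-at : wordB m (suc (toℕ t)) t ≡ suc m
wordB-at {t = t} with suc (toℕ t) ≟ suc (toℕ t)
... | yes _ = refl
... | no t≢t = contradiction refl t≢t

wordB-off : k ≢ t → wordB m (suc (toℕ t)) k ≡ 0
wordB-off {k = k} {t = t} k≢t with suc (toℕ k) ≟ suc (toℕ t)
... | yes k≡t = contradiction (toℕ-injective (suc-injective k≡t)) k≢t
... | no _ = refl

wordB-isMNWord : (t : Fin n) → 1 ≤ toℕ t → IsMNWord m n (wordB m (suc (toℕ t)))
wordB-isMNWord {m = m} t 1≤t = bounded , mn1 , mn2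
  where
  b : Word _
  b = wordB m (suc (toℕ t))
  bounded : ∀ k → b k ≤ suc m
  bounded k with k ≟ᶠ t
  ... | yes refl = ≤-reflexive wordB-at
  ... | no k≢t = subst (_≤ suc m) (sym (wordB-off k≢t)) z≤n
  mn1 : ∀ k → toℕ k ≡ 0 → b k ≢ suc m
  mn1 k k≡0 = 0≢1+n ∘ trans (sym (wordB-off k≢t))
    where
    k≢t : k ≢ t
    k≢t refl = <⇒≢ 1≤t (sym k≡0)
  mn2 : ∀ a c s → 1 ≤ s → s ≤ m → b a ≡ s → toℕ c < toℕ a → s ≤ b c
  mn2 a _ s 1≤s s≤m ba≡s _ with a ≟ᶠ t
  ... | yes refl = contradiction (subst (_≤ m) (trans (sym ba≡s) wordB-at) s≤m) 1+n≰n
  ... | no a≢t = contradiction (trans (sym ba≡s) (wordB-off a≢t)) (n>0⇒n≢0 1≤s)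

-- A join of two words that both lower the letter at the pivot t lies below y,
-- so it cannot reach x_t.
pivot⇒joinIrreducible : {y : Word n} (t : Fin n) → w ≈ʷ x → IsMNWord m n y → y t < x t →
  (∀ p → IsMNWord m n p → p ≤ʷ x → p t ≡ x t → p ≈ʷ x) →
  (∀ p → p ≤ʷ x → p t < x t → p ≤ʷ y) →
  JoinIrreducible m n w
pivot⇒joinIrreducible {w = w} {x = x} {m = m} {y = y} t w≈x y∈W yt<xt keeps lowers =
  w≠⊥ , irreducible
  where
  below-x : p ≤ʷ w → p ≤ʷ x
  below-x {p = p} p≤w k = subst (p k ≤_) (w≈x k) (p≤w k)
  w≠⊥ : ¬ IsBottomIn m _ w
  w≠⊥ (_ , least) = <⇒≱ yt<xt (≤-trans (subst (_≤ 0) (w≈x t) (least 0ʷ 0ʷ-isMNWord t)) z≤n)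
  equal-or-lower : ∀ p → IsMNWord m _ p → p ≤ʷ w → p ≈ʷ w ⊎ p ≤ʷ y
  equal-or-lower p p∈W p≤w with p t ≟ x t
  ... | yes pt≡xt = inj₁ λ k → trans (keeps p p∈W (below-x p≤w) pt≡xt k) (sym (w≈x k))
  ... | no pt≢xt = inj₂ (lowers p (below-x p≤w) (≤∧≢⇒< (below-x p≤w t) pt≢xt))
  irreducible : ∀ p q → IsMNWord m _ p → IsMNWord m _ q → IsJoinIn m _ p q w → p ≈ʷ w ⊎ q ≈ʷ w
  irreducible p q p∈W q∈W (_ , p≤w , q≤w , least)
    with equal-or-lower p p∈W p≤w | equal-or-lower q q∈W q≤w
  ... | inj₁ p≈w | _ = inj₁ p≈w
  ... | inj₂ _ | inj₁ q≈w = inj₂ q≈w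
  ... | inj₂ p≤y | inj₂ q≤y =
    contradiction (subst (_≤ y t) (w≈x t) (least y y∈W p≤y q≤y t)) (<⇒≱ yt<xt)

wordA-joinIrreducible : (t : Fin n) → suc j ≤ m →
  w ≈ʷ wordA (suc (toℕ t)) (suc j) → JoinIrreducible m n w
wordA-joinIrreducible {j = j} {m = m} t j<m w≈a =
  pivot⇒joinIrreducible t w≈a y∈W y<a keeps lowers
  where
  a y : Word _
  a = wordA (suc (toℕ t)) (suc j)
  y = wordA (toℕ t) (suc j) ⊔ʷ wordA (suc (toℕ t)) j
  y∈W : IsMNWord m _ y
  y∈W = ⊔ʷ-isMNWord (wordA-isMNWord {i = toℕ t} j<m) (wordA-isMNWord {i = suc (toℕ t)} (<⇒≤ j<m))
  at : a t ≡ suc j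
  at = wordA-inside ≤-refl
  y<a : y t < a t
  y<a = begin-strict
    y t    ≡⟨ cong₂ _⊔_ (wordA-outside {i = toℕ t} {j = suc j} ≤-refl) (wordA-inside {i = suc (toℕ t)} ≤-refl) ⟩
    j      <⟨ n<1+n j ⟩
    suc j  ≡⟨ at ⟨
    a t    ∎
    where open ≤-Reasoning
  keeps : ∀ p → IsMNWord m _ p → p ≤ʷ a → p t ≡ a t → p ≈ʷ a
  keeps p (_ , _ , mn2) p≤a pt≡at k with <-cmpᶠ k t
  ... | tri< k<t _ _ = ≤-antisym (p≤a k)
    (subst (_≤ p k) (sym (wordA-inside (m<n⇒m<1+n k<t)))
      (mn2 t k (suc j) (s≤s z≤n) j<m (trans pt≡at at) k<t))
  ... | tri≈ _ refl _ = pt≡at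
  ... | tri> _ _ t<k = trans (≤ʷ-zero p≤a ak≡0) (sym ak≡0)
    where
    ak≡0 : a k ≡ 0
    ak≡0 = wordA-outside t<k
  lowers : ∀ p → p ≤ʷ a → p t < a t → p ≤ʷ y
  lowers p p≤a pt<at k with <-cmpᶠ k t
  ... | tri< k<t _ _ = begin
    p k                      ≤⟨ p≤a k ⟩
    a k                      ≡⟨ wordA-inside (m<n⇒m<1+n k<t) ⟩
    suc j                    ≡⟨ wordA-inside k<t ⟨
    wordA (toℕ t) (suc j) k  ≤⟨ m≤m⊔n _ _ ⟩
    y k                      ∎
    where open ≤-Reasoning
  ... | tri≈ _ refl _ = begin
    p t                          ≤⟨ s≤s⁻¹ (subst (p t <_) at pt<at) ⟩
    j                            ≡⟨ wordA-inside ≤-refl ⟨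
    wordA (suc (toℕ t)) j t      ≤⟨ m≤n⊔m _ _ ⟩
    y t                          ∎
    where open ≤-Reasoning
  ... | tri> _ _ t<k = subst (_≤ y k) (sym (≤ʷ-zero p≤a (wordA-outside t<k))) z≤n

wordB-joinIrreducible : (t : Fin n) → 1 ≤ toℕ t →
  w ≈ʷ wordB m (suc (toℕ t)) → JoinIrreducible m n w
wordB-joinIrreducible {m = m} t _ w≈b =
  pivot⇒joinIrreducible t w≈b (wordA-isMNWord ≤-refl) y<b keeps lowers
  where
  b y : Word _
  b = wordB m (suc (toℕ t))
  y = wordA (suc (toℕ t)) m
  y<b : y t < b t
  y<b = subst₂ _<_ (sym (wordA-inside ≤-refl)) (sym wordB-at) (n<1+n m)
  keeps : ∀ p → IsMNWord m _ p → p ≤ʷ b → p t ≡ b t → p ≈ʷ b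
  keeps p _ p≤b pt≡bt k with k ≟ᶠ t
  ... | yes refl = pt≡bt
  ... | no k≢t = trans (≤ʷ-zero p≤b (wordB-off k≢t)) (sym (wordB-off k≢t))
  lowers : ∀ p → p ≤ʷ b → p t < b t → p ≤ʷ y
  lowers p p≤b pt<bt k with k ≟ᶠ t
  ... | yes refl = subst (p t ≤_) (sym (wordA-inside ≤-refl)) (s≤s⁻¹ (subst (p t <_) wordB-at pt<bt))
  ... | no k≢t = subst (_≤ y k) (sym (≤ʷ-zero p≤b (wordB-off k≢t))) z≤n

principal : (m : ℕ) → Word n → Fin n → Word n
principal m w k with w k ≤? m
... | yes _ = wordA (suc (toℕ k)) (w k)
... | no _ = wordB m (suc (toℕ k))

principal-isMNWord : IsMNWord m n w → ∀ k → IsMNWord m n (principal m w k)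
principal-isMNWord {m = m} {w = w} w∈W k with w k ≤? m
... | yes wk≤m = wordA-isMNWord wk≤m
... | no wk≰m = wordB-isMNWord k (≰m⇒position>0 w∈W wk≰m)

principal-≤ʷ : IsMNWord m n w → ∀ k → principal m w k ≤ʷ w
principal-≤ʷ {m = m} {w = w} w∈W k l with w k ≤? m
... | no wk≰m with l ≟ᶠ k
...   | yes refl = ≤-reflexive (trans wordB-at (sym (≰m⇒≡suc w∈W wk≰m)))
...   | no l≢k = subst (_≤ w l) (sym (wordB-off l≢k)) z≤n
principal-≤ʷ {m = m} {w = w} w∈W k l | yes wk≤m with <-cmpᶠ l k
...   | tri< l<k _ _ = subst (_≤ w l) (sym (wordA-inside (m<n⇒m<1+n l<k))) (≤m⇒earlier-≥ w∈W wk≤m l<k)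
...   | tri≈ _ refl _ = ≤-reflexive (wordA-inside ≤-refl)
...   | tri> _ _ k<l = subst (_≤ w l) (sym (wordA-outside k<l)) z≤n

principal-self : IsMNWord m n w → ∀ k → principal m w k k ≡ w k
principal-self {m = m} {w = w} w∈W k with w k ≤? m
... | yes _ = wordA-inside ≤-refl
... | no wk≰m = trans wordB-at (sym (≰m⇒≡suc w∈W wk≰m))

≈ʷ-⋁-principal : IsMNWord m n w → w ≈ʷ ⋁ (principal m w)
≈ʷ-⋁-principal {m = m} {w = w} w∈W k = ≤-antisym
  (subst (_≤ ⋁ (principal m w) k) (principal-self w∈W k) (⋁-upper (principal m w) k k))
  (⋁-least (principal m w) (principal-≤ʷ w∈W) k)

principal-listed : IsMNWord m n w → ¬ IsBottomIn m n w → ∀ k →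
  w ≈ʷ principal m w k → IsAWord m n w ⊎ IsBWord m n w
principal-listed {m = m} {w = w} w∈W w≠⊥ k w≈pk with w k ≤? m
... | no wk≰m = inj₂ (suc (toℕ k) , s≤s (≰m⇒position>0 w∈W wk≰m) , toℕ<n k , w≈pk)
... | yes wk≤m with w k ≟ 0
...   | no wk≢0 = inj₁ (suc (toℕ k) , w k , s≤s z≤n , toℕ<n k , n≢0⇒n>0 wk≢0 , wk≤m , w≈pk)
...   | yes wk≡0 = contradiction (0ʷ-isBottom w∈W w≈0) w≠⊥
  where
  w≈0 : w ≈ʷ 0ʷ
  w≈0 l = n≤0⇒n≡0 (subst (w l ≤_) wk≡0 (subst (_≤ w k) (sym (w≈pk l)) (wordA-≤ l)))

joinIrreducible⇒listed : IsMNWord m n w → JoinIrreducible m n w → IsAWord m n w ⊎ IsBWord m n w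
joinIrreducible⇒listed {m = m} {w = w} w∈W w-ji@(w≠⊥ , _)
  with joinIrreducible⇒joinand w∈W w-ji (principal m w) (principal-isMNWord w∈W) (≈ʷ-⋁-principal w∈W)
... | k , pk≈w = principal-listed w∈W w≠⊥ k (sym ∘ pk≈w)

listed⇒joinIrreducible : IsAWord m n w ⊎ IsBWord m n w → JoinIrreducible m n w
listed⇒joinIrreducible {w = w} (inj₁ (suc i , suc j , _ , i≤n , _ , j<m , w≈a)) =
  wordA-joinIrreducible (fromℕ< i≤n) j<m
    (subst (λ i → w ≈ʷ wordA (suc i) (suc j)) (sym (toℕ-fromℕ< i≤n)) w≈a)
listed⇒joinIrreducible {m = m} {w = w} (inj₂ (suc i , s≤s 1≤i , i≤n , w≈b)) =
  wordB-joinIrreducible (fromℕ< i≤n) (subst (1 ≤_) (sym (toℕ-fromℕ< i≤n)) 1≤i)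
    (subst (λ i → w ≈ʷ wordB m (suc i)) (sym (toℕ-fromℕ< i≤n)) w≈b)

lemma4p5 : (m n : ℕ) → (w : Word n) → IsMNWord m n w →
    JoinIrreducible m n w ⇔
      ((∃[ i ] ∃[ j ] (1 ≤ i × i ≤ n × 1 ≤ j × j ≤ m × w ≈ʷ wordA i j))
       ⊎ (∃[ i ] (2 ≤ i × i ≤ n × w ≈ʷ wordB m i)))
lemma4p5 m n w w∈W = mk⇔ (joinIrreducible⇒listed w∈W) listed⇒joinIrreducible
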